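{- Let $q \ge 2$, $n$, $t$ be positive integers with $t \le 10\sqrt{n}$. For every integer $k$ with $0 \le k \le t$ and $k+1 \le n$, \[ W_q(n,t,k+1) \le W_q(n,t,k). \]
   Context: For $x,y \in [q]^n$, $d(x,y)$ is the Hamming distance and $B_q(x,r) = \{ y \in [q]^n : d(x,y) \le r\}$. For $0 \le k \le n$, $W_q(n,t,k)$ denotes $|B_q(x,t) \cap B_q(y,t)|$ for any $x, y \in [q]^n$ with $d(x,y) = k$ (this does not depend on the choice of $x,y$). -}

module Defs where

open import Data.Nat using (ℕ; zero; suc; _+_; _≤_; _≤?_)
open import Data.Fin using (Fin)
open import Data.Fin.Properties using (_≟_)
open import Data.Vec using (Vec; []; _∷_)
open import Data.List using (List; []; _∷_; length; filter; map; concatMap)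
open import Data.List using (allFin)
open import Data.Product using (_×_)
open import Relation.Nullary.Decidable using (yes; no; _×-dec_)

Word : ℕ → ℕ → Set
Word q n = Vec (Fin q) n

dist : ∀ {q n} → Word q n → Word q n → ℕ
dist [] [] = 0
dist (a ∷ x) (b ∷ y) with a ≟ b
... | yes _ = dist x y
... | no  _ = suc (dist x y)

-- Complete enumeration of [q]^n (each word exactly once).
allWords : (q n : ℕ) → List (Word q n)
allWords q zero = [] ∷ []
allWords q (suc n) = concatMap (λ a → map (a ∷_) (allWords q n)) (allFin q)

ballInter : ∀ {q n} → ℕ → Word q n → Word q n → ℕ
ballInter {q} {n} t x y =
  length (filter (λ z → (dist x z ≤? t) ×-dec (dist y z ≤? t)) (allWords q n))

{-# OPTIONS --safe #-}
module Submission where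

-- Write q = m + 2 and shrink the two radii by offsets: count x y i j is the number of words
-- within distance t - i of x and t - j of y. Appending a coordinate on which x and y agree
-- (resp. disagree) transforms count by a linear operator matchStep (resp. mismatchStep), and the
-- two operators commute, so count x y depends only on the numbers of agreements and
-- disagreements of x and y. The base case [i ≤ t] · [j ≤ t] is supermodular in (i, j), both
-- operators preserve supermodularity, and for a supermodular G supermodularity at (i, j) gives
-- mismatchStep m G ≤ matchStep (m + 1) G there: turning one disagreement into an agreement never
-- shrinks the intersection.

open import Defs
open import Data.Nat using (ℕ; zero; suc; _+_; _*_; _≤_; _≤?_; z≤n; s≤s)
open import Data.Nat.Properties
  using (+-suc; +-identityʳ; +-assoc; +-mono-≤; *-monoʳ-≤; ≤-refl; <⇒≤; m≤m+n;
         m≤n⇒∃[o]m+o≡n; +-cancelʳ-≡; module ≤-Reasoning)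
open import Data.Nat.GeneralisedArithmetic using (fold)
open import Data.Nat.ListAction using (sum)
open import Data.Nat.ListAction.Properties using (sum-++)
open import Data.Nat.Solver using (module +-*-Solver)
open import Data.Fin using (Fin; zero; suc)
open import Data.Fin.Properties using (_≟_)
open import Data.Vec using ([]; _∷_)
open import Data.List using (List; []; _∷_; _++_; length; filter; map; concatMap; tabulate; allFin)
open import Data.List.Properties using (map-++; map-∘; map-cong; map-tabulate)
open import Data.Bool using (if_then_else_)
open import Data.Product using (_×_; _,_)
open import Function using (_∘_)
open import Relation.Nullary using (Dec; yes; no; does; contradiction)
open import Relation.Nullary.Decidable using (_×-dec_)
open import Relation.Unary using (Pred; Decidable)
open import Relation.Binary.PropositionalEquality
  using (_≡_; _≢_; refl; sym; trans; cong; cong₂; module ≡-Reasoning)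
open +-*-Solver

indicator : ∀ {P : Set} → Dec P → ℕ
indicator (yes _) = 1
indicator (no  _) = 0

indicator-×-dec : ∀ {P Q : Set} (P? : Dec P) (Q? : Dec Q) →
  indicator (P? ×-dec Q?) ≡ indicator P? * indicator Q?
indicator-×-dec (yes _) (yes _) = refl
indicator-×-dec (yes _) (no  _) = refl
indicator-×-dec (no  _) _       = refl

indicator-≤?-antitone : ∀ t i → indicator (suc i ≤? t) ≤ indicator (i ≤? t)
indicator-≤?-antitone t i with suc i ≤? t | i ≤? t
... | yes _   | yes _  = ≤-refl
... | yes i<t | no i≰t = contradiction (<⇒≤ i<t) i≰t
... | no _    | _      = z≤n

length-filter≡sum-indicator : ∀ {A : Set} {P : Pred A _} (P? : Decidable P) (xs : List A) →
  length (filter P? xs) ≡ sum (map (indicator ∘ P?) xs)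
length-filter≡sum-indicator P? [] = refl
length-filter≡sum-indicator P? (x ∷ xs) with P? x
... | yes _ = cong suc (length-filter≡sum-indicator P? xs)
... | no  _ = length-filter≡sum-indicator P? xs

sum-map-concatMap : ∀ {A B : Set} (h : B → ℕ) (f : A → List B) (xs : List A) →
  sum (map h (concatMap f xs)) ≡ sum (map (sum ∘ map h ∘ f) xs)
sum-map-concatMap h f [] = refl
sum-map-concatMap h f (x ∷ xs) = begin
  sum (map h (f x ++ concatMap f xs))                 ≡⟨ cong sum (map-++ h (f x) _) ⟩
  sum (map h (f x) ++ map h (concatMap f xs))         ≡⟨ sum-++ (map h (f x)) _ ⟩
  sum (map h (f x)) + sum (map h (concatMap f xs))    ≡⟨ cong (_ +_) (sum-map-concatMap h f xs) ⟩
  sum (map h (f x)) + sum (map (sum ∘ map h ∘ f) xs)  ∎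
  where open ≡-Reasoning

sum-tabulate-const : ∀ m v → sum (tabulate {n = m} (λ _ → v)) ≡ m * v
sum-tabulate-const zero    v = refl
sum-tabulate-const (suc m) v = cong (v +_) (sum-tabulate-const m v)

mismatch : ∀ {q} → Fin q → Fin q → ℕ
mismatch a c = if does (a ≟ c) then 0 else 1

sum-mismatch : ∀ m (a : Fin (suc m)) (g : ℕ → ℕ) →
  sum (tabulate (g ∘ mismatch a)) ≡ g 0 + m * g 1
sum-mismatch m       zero    g = cong (g 0 +_) (sum-tabulate-const m (g 1))
sum-mismatch (suc m) (suc a) g = begin
  g 1 + sum (tabulate (g ∘ mismatch a))  ≡⟨ cong (g 1 +_) (sum-mismatch m a g) ⟩
  g 1 + (g 0 + m * g 1)                  ≡⟨ solve 3 (λ x y z → y :+ (x :+ z :* y) := x :+ (y :+ z :* y))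
                                              refl (g 0) (g 1) m ⟩
  g 0 + suc m * g 1                      ∎
  where open ≡-Reasoning

sum-mismatch₂ : ∀ m (a b : Fin (suc (suc m))) (f : ℕ → ℕ → ℕ) → a ≢ b →
  sum (tabulate (λ c → f (mismatch a c) (mismatch b c))) ≡ f 0 1 + f 1 0 + m * f 1 1
sum-mismatch₂ m zero zero f a≢b = contradiction refl a≢b
sum-mismatch₂ m zero (suc b) f _ = begin
  f 0 1 + sum (tabulate (f 1 ∘ mismatch b))  ≡⟨ cong (f 0 1 +_) (sum-mismatch m b (f 1)) ⟩
  f 0 1 + (f 1 0 + m * f 1 1)                ≡⟨ sym (+-assoc (f 0 1) _ _) ⟩
  f 0 1 + f 1 0 + m * f 1 1                  ∎
  where open ≡-Reasoning
sum-mismatch₂ m (suc a) zero f _ = begin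
  f 1 0 + sum (tabulate (λ c → f (mismatch a c) 1))  ≡⟨ cong (f 1 0 +_) (sum-mismatch m a (λ u → f u 1)) ⟩
  f 1 0 + (f 0 1 + m * f 1 1)                        ≡⟨ solve 4 (λ x y z w → y :+ (x :+ w :* z) := x :+ y :+ w :* z)
                                                          refl (f 0 1) (f 1 0) (f 1 1) m ⟩
  f 0 1 + f 1 0 + m * f 1 1                          ∎
  where open ≡-Reasoning
sum-mismatch₂ zero (suc zero) (suc zero) f a≢b = contradiction refl a≢b
sum-mismatch₂ (suc m) (suc a) (suc b) f a≢b = begin
  f 1 1 + sum (tabulate (λ c → f (mismatch a c) (mismatch b c)))
    ≡⟨ cong (f 1 1 +_) (sum-mismatch₂ m a b f (a≢b ∘ cong suc)) ⟩
  f 1 1 + (f 0 1 + f 1 0 + m * f 1 1)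
    ≡⟨ solve 4 (λ x y z w → z :+ (x :+ y :+ w :* z) := x :+ y :+ (z :+ w :* z))
         refl (f 0 1) (f 1 0) (f 1 1) m ⟩
  f 0 1 + f 1 0 + suc m * f 1 1
    ∎
  where open ≡-Reasoning

Grid : Set
Grid = ℕ → ℕ → ℕ

Supermodular : Grid → Set
Supermodular G = ∀ i j → G i (suc j) + G (suc i) j ≤ G i j + G (suc i) (suc j)

product-supermodular : (f g : ℕ → ℕ) → (∀ i → f (suc i) ≤ f i) → (∀ j → g (suc j) ≤ g j) →
  Supermodular (λ i j → f i * g j)
product-supermodular f g f↓ g↓ i j
  with a , fi≡ ← m≤n⇒∃[o]m+o≡n (f↓ i) | b , gj≡ ← m≤n⇒∃[o]m+o≡n (g↓ j)
  rewrite sym fi≡ | sym gj≡ = begin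
    (F + a) * G + F * (G + b)          ≤⟨ m≤m+n _ (a * b) ⟩
    (F + a) * G + F * (G + b) + a * b  ≡⟨ solve 4 (λ F G a b → (F :+ a) :* G :+ F :* (G :+ b) :+ a :* b
                                                       := (F :+ a) :* (G :+ b) :+ F :* G) refl F G a b ⟩
    (F + a) * (G + b) + F * G          ∎
  where
  open ≤-Reasoning
  F = f (suc i)
  G = g (suc j)

matchStep : ℕ → Grid → Grid
matchStep r G i j = G i j + r * G (suc i) (suc j)

mismatchStep : ℕ → Grid → Grid
mismatchStep s G i j = G i (suc j) + G (suc i) j + s * G (suc i) (suc j)

matchStep-supermodular : ∀ r G → Supermodular G → Supermodular (matchStep r G)
matchStep-supermodular r G sm i j = begin
  (G i (suc j) + r * G (suc i) (suc (suc j))) + (G (suc i) j + r * G (suc (suc i)) (suc j))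
    ≡⟨ solve 5 (λ a b c d x → (a :+ x :* b) :+ (c :+ x :* d) := (a :+ c) :+ x :* (b :+ d))
         refl (G i (suc j)) (G (suc i) (suc (suc j))) (G (suc i) j) (G (suc (suc i)) (suc j)) r ⟩
  (G i (suc j) + G (suc i) j) + r * (G (suc i) (suc (suc j)) + G (suc (suc i)) (suc j))
    ≤⟨ +-mono-≤ (sm i j) (*-monoʳ-≤ r (sm (suc i) (suc j))) ⟩
  (G i j + G (suc i) (suc j)) + r * (G (suc i) (suc j) + G (suc (suc i)) (suc (suc j)))
    ≡⟨ solve 5 (λ a b c d x → (a :+ b) :+ x :* (c :+ d) := (a :+ x :* c) :+ (b :+ x :* d))
         refl (G i j) (G (suc i) (suc j)) (G (suc i) (suc j)) (G (suc (suc i)) (suc (suc j))) r ⟩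
  (G i j + r * G (suc i) (suc j)) + (G (suc i) (suc j) + r * G (suc (suc i)) (suc (suc j)))
    ∎
  where open ≤-Reasoning

mismatchStep-supermodular : ∀ s G → Supermodular G → Supermodular (mismatchStep s G)
mismatchStep-supermodular s G sm i j = begin
  (G i (suc (suc j)) + G (suc i) (suc j) + s * G (suc i) (suc (suc j)))
    + (G (suc i) (suc j) + G (suc (suc i)) j + s * G (suc (suc i)) (suc j))
    ≡⟨ solve 7 (λ a b c d e f x → (a :+ b :+ x :* c) :+ (d :+ e :+ x :* f)
                 := (a :+ b) :+ (d :+ e) :+ x :* (c :+ f))
         refl (G i (suc (suc j))) (G (suc i) (suc j)) (G (suc i) (suc (suc j)))
              (G (suc i) (suc j)) (G (suc (suc i)) j) (G (suc (suc i)) (suc j)) s ⟩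
  (G i (suc (suc j)) + G (suc i) (suc j)) + (G (suc i) (suc j) + G (suc (suc i)) j)
    + s * (G (suc i) (suc (suc j)) + G (suc (suc i)) (suc j))
    ≤⟨ +-mono-≤ (+-mono-≤ (sm i (suc j)) (sm (suc i) j)) (*-monoʳ-≤ s (sm (suc i) (suc j))) ⟩
  (G i (suc j) + G (suc i) (suc (suc j))) + (G (suc i) j + G (suc (suc i)) (suc j))
    + s * (G (suc i) (suc j) + G (suc (suc i)) (suc (suc j)))
    ≡⟨ solve 7 (λ a b c d e f x → (a :+ b) :+ (c :+ d) :+ x :* (e :+ f)
                 := (a :+ c :+ x :* e) :+ (b :+ d :+ x :* f))
         refl (G i (suc j)) (G (suc i) (suc (suc j))) (G (suc i) j) (G (suc (suc i)) (suc j))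
              (G (suc i) (suc j)) (G (suc (suc i)) (suc (suc j))) s ⟩
  (G i (suc j) + G (suc i) j + s * G (suc i) (suc j))
    + (G (suc i) (suc (suc j)) + G (suc (suc i)) (suc j) + s * G (suc (suc i)) (suc (suc j)))
    ∎
  where open ≤-Reasoning

fold-supermodular : ∀ (step : Grid → Grid) → (∀ G → Supermodular G → Supermodular (step G)) →
  ∀ G → Supermodular G → ∀ e → Supermodular (fold G step e)
fold-supermodular step preserves G sm zero    = sm
fold-supermodular step preserves G sm (suc e) = preserves _ (fold-supermodular step preserves G sm e)

matchStep-mismatchStep-comm : ∀ r s G i j →
  matchStep r (mismatchStep s G) i j ≡ mismatchStep s (matchStep r G) i j
matchStep-mismatchStep-comm r s G i j = solve 8 (λ a b c d e f r s →
    (a :+ b :+ s :* c) :+ r :* (d :+ e :+ s :* f)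
    := (a :+ r :* d) :+ (b :+ r :* e) :+ s :* (c :+ r :* f)) refl
  (G i (suc j)) (G (suc i) j) (G (suc i) (suc j))
  (G (suc i) (suc (suc j))) (G (suc (suc i)) (suc j)) (G (suc (suc i)) (suc (suc j))) r s

fold-matchStep-mismatchStep-comm : ∀ r s G e i j →
  fold (mismatchStep s G) (matchStep r) e i j ≡ mismatchStep s (fold G (matchStep r) e) i j
fold-matchStep-mismatchStep-comm r s G zero    i j = refl
fold-matchStep-mismatchStep-comm r s G (suc e) i j = begin
  matchStep r (fold (mismatchStep s G) (matchStep r) e) i j
    ≡⟨ cong₂ (λ u v → u + r * v) (fold-matchStep-mismatchStep-comm r s G e i j)
                                   (fold-matchStep-mismatchStep-comm r s G e (suc i) (suc j)) ⟩
  matchStep r (mismatchStep s (fold G (matchStep r) e)) i j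
    ≡⟨ matchStep-mismatchStep-comm r s (fold G (matchStep r) e) i j ⟩
  mismatchStep s (matchStep r (fold G (matchStep r) e)) i j
    ∎
  where open ≡-Reasoning

mismatchStep≤matchStep : ∀ s G → Supermodular G → ∀ i j → mismatchStep s G i j ≤ matchStep (suc s) G i j
mismatchStep≤matchStep s G sm i j = begin
  G i (suc j) + G (suc i) j + s * G (suc i) (suc j)      ≤⟨ +-mono-≤ (sm i j) ≤-refl ⟩
  G i j + G (suc i) (suc j) + s * G (suc i) (suc j)      ≡⟨ +-assoc (G i j) _ _ ⟩
  G i j + suc s * G (suc i) (suc j)                      ∎
  where open ≤-Reasoning

agreements : ∀ {q n} → Word q n → Word q n → ℕ
agreements []      []      = 0
agreements (a ∷ x) (b ∷ y) with a ≟ b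
... | yes _ = suc (agreements x y)
... | no  _ = agreements x y

agreements+dist : ∀ {q n} (x y : Word q n) → agreements x y + dist x y ≡ n
agreements+dist []      []      = refl
agreements+dist (a ∷ x) (b ∷ y) with a ≟ b
... | yes _ = cong suc (agreements+dist x y)
... | no  _ = trans (+-suc (agreements x y) (dist x y)) (cong suc (agreements+dist x y))

module Overlap (m t : ℕ) where

  q : ℕ
  q = suc (suc m)

  close? : ∀ {n} (x y : Word q n) (i j : ℕ) → Decidable (λ z → i + dist x z ≤ t × j + dist y z ≤ t)
  close? x y i j z = (i + dist x z ≤? t) ×-dec (j + dist y z ≤? t)

  count : ∀ {n} → Word q n → Word q n → Grid
  count {n} x y i j = sum (map (indicator ∘ close? x y i j) (allWords q n))

  ballInter≡count : ∀ {n} (x y : Word q n) → ballInter t x y ≡ count x y 0 0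
  ballInter≡count {n} x y = length-filter≡sum-indicator (close? x y 0 0) (allWords q n)

  close?-∷ : ∀ {n} (a b c : Fin q) (x y z : Word q n) i j →
    indicator (close? (a ∷ x) (b ∷ y) i j (c ∷ z))
      ≡ indicator (close? x y (mismatch a c + i) (mismatch b c + j) z)
  close?-∷ a b c x y z i j with a ≟ c | b ≟ c
  ... | yes _ | yes _ = refl
  ... | yes _ | no  _ rewrite +-suc j (dist y z) = refl
  ... | no  _ | yes _ rewrite +-suc i (dist x z) = refl
  ... | no  _ | no  _ rewrite +-suc i (dist x z) | +-suc j (dist y z) = refl

  count-∷ : ∀ {n} (a b : Fin q) (x y : Word q n) i j →
    count (a ∷ x) (b ∷ y) i j ≡ sum (tabulate (λ c → count x y (mismatch a c + i) (mismatch b c + j)))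
  count-∷ {n} a b x y i j = begin
    sum (map (indicator ∘ close? (a ∷ x) (b ∷ y) i j) (concatMap extend (allFin q)))
      ≡⟨ sum-map-concatMap _ extend (allFin q) ⟩
    sum (map (λ c → sum (map (indicator ∘ close? (a ∷ x) (b ∷ y) i j) (extend c))) (allFin q))
      ≡⟨ cong sum (map-cong count-extend (allFin q)) ⟩
    sum (map (λ c → count x y (mismatch a c + i) (mismatch b c + j)) (allFin q))
      ≡⟨ cong sum (map-tabulate (λ c → c) (λ c → count x y (mismatch a c + i) (mismatch b c + j))) ⟩
    sum (tabulate (λ c → count x y (mismatch a c + i) (mismatch b c + j)))
      ∎
    where
    open ≡-Reasoning
    extend : Fin q → List (Word q (suc n))
    extend c = map (c ∷_) (allWords q n)
    count-extend : ∀ c → sum (map (indicator ∘ close? (a ∷ x) (b ∷ y) i j) (extend c))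
                           ≡ count x y (mismatch a c + i) (mismatch b c + j)
    count-extend c = trans (cong sum (sym (map-∘ (allWords q n))))
                           (cong sum (map-cong (λ z → close?-∷ a b c x y z i j) (allWords q n)))

  count-match : ∀ {n} (a : Fin q) (x y : Word q n) i j →
    count (a ∷ x) (a ∷ y) i j ≡ matchStep (suc m) (count x y) i j
  count-match a x y i j =
    trans (count-∷ a a x y i j) (sum-mismatch (suc m) a (λ u → count x y (u + i) (u + j)))

  count-mismatch : ∀ {n} (a b : Fin q) (x y : Word q n) i j → a ≢ b →
    count (a ∷ x) (b ∷ y) i j ≡ mismatchStep m (count x y) i j
  count-mismatch a b x y i j a≢b =
    trans (count-∷ a b x y i j) (sum-mismatch₂ m a b (λ u v → count x y (u + i) (v + j)) a≢b)

  count-[] : ∀ i j → count [] [] i j ≡ indicator (i ≤? t) * indicator (j ≤? t)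
  count-[] i j rewrite +-identityʳ i | +-identityʳ j =
    trans (+-identityʳ _) (indicator-×-dec (i ≤? t) (j ≤? t))

  count-[]-supermodular : Supermodular (count [] [])
  count-[]-supermodular i j
    rewrite count-[] i (suc j) | count-[] (suc i) j | count-[] i j | count-[] (suc i) (suc j) =
    product-supermodular (λ i → indicator (i ≤? t)) (λ j → indicator (j ≤? t))
      (indicator-≤?-antitone t) (indicator-≤?-antitone t) i j

  profile : ℕ → ℕ → Grid
  profile e d = fold (fold (count [] []) (mismatchStep m) d) (matchStep (suc m)) e

  profile-supermodular : ∀ e d → Supermodular (profile e d)
  profile-supermodular e d =
    fold-supermodular (matchStep (suc m)) (matchStep-supermodular (suc m))
      (fold (count [] []) (mismatchStep m) d)
      (fold-supermodular (mismatchStep m) (mismatchStep-supermodular m) (count [] []) count-[]-supermodular d) e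

  profile-suc-dist : ∀ e d i j → profile e (suc d) i j ≡ mismatchStep m (profile e d) i j
  profile-suc-dist e d = fold-matchStep-mismatchStep-comm (suc m) m _ e

  count≡profile : ∀ {n} (x y : Word q n) i j → count x y i j ≡ profile (agreements x y) (dist x y) i j
  count≡profile []      []      i j = refl
  count≡profile (a ∷ x) (b ∷ y) i j with a ≟ b
  ... | yes refl = trans (count-match a x y i j)
                     (cong₂ (λ u v → u + suc m * v) (count≡profile x y i j) (count≡profile x y (suc i) (suc j)))
  ... | no a≢b = begin
    count (a ∷ x) (b ∷ y) i j                   ≡⟨ count-mismatch a b x y i j a≢b ⟩
    mismatchStep m (count x y) i j              ≡⟨ cong₂ _+_ (cong₂ _+_ (count≡profile x y i (suc j))
                                                                       (count≡profile x y (suc i) j))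
                                                              (cong (m *_) (count≡profile x y (suc i) (suc j))) ⟩
    mismatchStep m (profile e (dist x y)) i j   ≡⟨ profile-suc-dist e (dist x y) i j ⟨
    profile e (suc (dist x y)) i j              ∎
    where
    open ≡-Reasoning
    e = agreements x y

  profile-trade : ∀ e d i j → profile e (suc d) i j ≤ profile (suc e) d i j
  profile-trade e d i j = begin
    profile e (suc d) i j                ≡⟨ profile-suc-dist e d i j ⟩
    mismatchStep m (profile e d) i j     ≤⟨ mismatchStep≤matchStep m (profile e d) (profile-supermodular e d) i j ⟩
    profile (suc e) d i j                ∎
    where open ≤-Reasoning

lemma3p4 : (q n t k : ℕ) → 2 ≤ q → 1 ≤ n → 1 ≤ t → t * t ≤ 100 * n →
    k ≤ t → suc k ≤ n →
    (x y x′ y′ : Word q n) → dist x y ≡ suc k → dist x′ y′ ≡ k →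
    ballInter t x y ≤ ballInter t x′ y′
lemma3p4 (suc (suc m)) n t k (s≤s (s≤s _)) _ _ _ _ _ x y x′ y′ dxy≡1+k dx′y′≡k = begin
  ballInter t x y                              ≡⟨ ballInter≡count x y ⟩
  count x y 0 0                                ≡⟨ count≡profile x y 0 0 ⟩
  profile e (dist x y) 0 0                     ≡⟨ cong (λ d → profile e d 0 0) dxy≡1+k ⟩
  profile e (suc k) 0 0                        ≤⟨ profile-trade e k 0 0 ⟩
  profile (suc e) k 0 0                        ≡⟨ cong₂ (λ e′ d → profile e′ d 0 0) 1+e≡e′ (sym dx′y′≡k) ⟩
  profile (agreements x′ y′) (dist x′ y′) 0 0  ≡⟨ count≡profile x′ y′ 0 0 ⟨
  count x′ y′ 0 0                              ≡⟨ ballInter≡count x′ y′ ⟨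
  ballInter t x′ y′                            ∎
  where
  open Overlap m t
  open ≤-Reasoning
  e = agreements x y
  1+e≡e′ : suc e ≡ agreements x′ y′
  1+e≡e′ = +-cancelʳ-≡ k _ _ (begin-equality
    suc e + k            ≡⟨ +-suc e k ⟨
    e + suc k            ≡⟨ cong (e +_) dxy≡1+k ⟨
    e + dist x y         ≡⟨ agreements+dist x y ⟩
    n                    ≡⟨ agreements+dist x′ y′ ⟨
    agreements x′ y′ + dist x′ y′  ≡⟨ cong (agreements x′ y′ +_) dx′y′≡k ⟩
    agreements x′ y′ + k ∎)
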